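{- Let $a_1,\dots,a_s$ be positive integers (a multiset; in the paper these are the integers $m$ for $(\chi,m,\alpha)\in\mathbf{e}$ together with $n_1,\dots,n_t$), and let $l$ be even and $0<m_1<m_2<\cdots<m_l$ integers. Put $2k=\sum_{j=1}^l(2m_j+1)$ and $2n=2\sum_{i=1}^s a_i+2k$, and let $\underline{p}(\psi)=[a_1^2\cdots a_s^2(2m_1+1)\cdots(2m_l+1)]$, a partition of $2n$. Then $$\eta_{\mathfrak{o}_{2n},\mathfrak{o}_{2n}}(\underline{p}(\psi))=\Big(2[a_1\cdots a_s]^t+\eta_{\mathfrak{o}_{2k},\mathfrak{o}_{2k}}([(2m_1+1)\cdots(2m_l+1)])\Big)_{\mathrm{O}_{2n}}.$$
   Context: Partitions are written $[p_r\cdots p_1]$ with parts in nonincreasing order; $a^2$ means $a$ repeated twice. $\underline{p}^t$ is the transpose partition. For partitions $\underline{p},\underline{q}$ (padded with zeros), $\underline{p}+\underline{q}$ is the partition whose $i$-th largest part is the sum of the $i$-th largest parts, and $2\underline{p}=\underline{p}+\underline{p}$. $\underline{p}_{\mathrm{O}_{2N}}$ is the $\mathrm{O}_{2N}$-collapse: the largest (in dominance order) orthogonal partition of $2N$ (even parts occur with even multiplicity) dominated by $\underline{p}$. The Barbasch–Vogan–Spaltenstein duality is $\eta_{\mathfrak{o}_{2N},\mathfrak{o}_{2N}}(\underline{p})=(\underline{p}^t)_{\mathrm{O}_{2N}}$ for a partition $\underline{p}$ of $2N$. -}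

module Defs where

open import Data.Nat using (ℕ; zero; suc; _+_; _*_; _≤_; _<_; _≥_; _⊔_; _≤?_)
open import Data.Nat.Divisibility using (_∣_)
open import Data.Nat.ListAction using (sum)
open import Data.List using (List; []; _∷_; _++_; map; length; filter; take; foldr; upTo; concatMap)
open import Data.List.Relation.Unary.All using (All)
open import Data.List.Relation.Unary.Linked using (Linked)
open import Data.Product using (_×_)
open import Relation.Binary.PropositionalEquality using (_≡_)
open import Data.Nat using (_≟_)

Even : ℕ → Set
Even n = 2 ∣ n

IsPartition : List ℕ → Set
IsPartition q = Linked _≥_ q × All (0 <_) q

maxPart : List ℕ → ℕ
maxPart = foldr _⊔_ 0

countGe : ℕ → List ℕ → ℕ
countGe i p = length (filter (i ≤?_) p)

mult : ℕ → List ℕ → ℕ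
mult i p = length (filter (_≟ i) p)

-- transpose partition: i-th part (i = 1 .. max p) = #{ j : p_j ≥ i }.
-- (independent of the order in which the parts of p are listed)
transpose : List ℕ → List ℕ
transpose p = map (λ i → countGe (suc i) p) (upTo (maxPart p))

-- sum of partitions, i-th largest parts added (lists assumed nonincreasing, zero-padded)
addP : List ℕ → List ℕ → List ℕ
addP [] q = q
addP p [] = p
addP (x ∷ xs) (y ∷ ys) = (x + y) ∷ addP xs ys

Dom : List ℕ → List ℕ → Set
Dom r q = ∀ j → sum (take j r) ≤ sum (take j q)

Orth : List ℕ → Set
Orth q = ∀ i → Even i → Even (mult i q)

IsOCollapse : List ℕ → List ℕ → Set
IsOCollapse p q =
  IsPartition q × Orth q × sum q ≡ sum p × Dom q p ×
  (∀ r → IsPartition r → Orth r → sum r ≡ sum p → Dom r p → Dom r q)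

-- q = η_{o,o}(p) = (p^t)_O
IsBVdual : List ℕ → List ℕ → Set
IsBVdual p q = IsOCollapse (transpose p) q

doubled : List ℕ → List ℕ
doubled = concatMap (λ a → a ∷ a ∷ [])

oddParts : List ℕ → List ℕ
oddParts = map (λ m → 2 * m + 1)

-- Write A = [a₁⋯aₛ]ᵗ, O = [(2m₁+1)⋯(2mₗ+1)] and P = [a₁²⋯aₛ²(2m₁+1)⋯(2mₗ+1)]. The j-th partial sum of a
-- transpose qᵗ is Σᵢ min(qᵢ, j), so Pᵗ has the partial sums of 2A + Oᵗ; as η(O) ≤ Oᵗ, the partition
-- r = (2A + η(O))_O is dominated by Pᵗ and has the same size. For maximality let x be the transpose of the
-- even partition [2m₁ (2m₂+2) 2m₃ (2m₄+2) ⋯]. It is orthogonal (the transpose of 2q is qᵗ with every part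
-- doubled) and below Oᵗ, hence below η(O). The partial sums of Oᵗ exceed those of x at most by one, and only
-- at the j with 2m₂ᵢ₋₁ < j ≤ 2m₂ᵢ + 1; there the partial sum of Oᵗ plus j is odd, and the number of odd parts
-- ≥ j is odd or drops at j. If an orthogonal r′ ≤ Pᵗ reached the j-th partial sum of Pᵗ with that parity,
-- its j-th and (j+1)-st parts would be equal and even, which squeezes the j-th and (j+1)-st parts of Pᵗ to
-- the same even value — impossible at such a j. So every orthogonal r′ ≤ Pᵗ lies below 2A + x ≤ 2A + η(O),
-- hence below r.
module Submission where

open import Algebra.Properties.CommutativeSemigroup using (interchange)
open import Data.Bool using (Bool; true; false; not; _∧_; _xor_)
open import Data.Bool.Properties
  using (not-involutive; not-injective; not-distribˡ-xor; ¬-not; ∧-conicalˡ; ∧-zeroʳ; xor-assoc; xor-comm; xor-identityʳ)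
open import Data.Empty using (⊥-elim)
open import Data.List using (List; []; _∷_; _++_; map; length; take; filter; applyUpTo)
open import Data.List.Properties
  using (take-all; length-map; length-++; length-applyUpTo; filter-++; filter-accept; filter-reject; map-upTo; map-++)
open import Data.List.Relation.Unary.All as All using (All; []; _∷_)
import Data.List.Relation.Unary.All.Properties as Allₚ
open import Data.List.Relation.Unary.Linked as Linked using (Linked; []; [-]; _∷_)
open import Data.List.Relation.Unary.Linked.Properties as Linkedₚ using (Linked⇒All)
open import Data.Nat using (ℕ; zero; suc; _+_; _*_; _≤_; _<_; _≥_; _⊔_; _⊓_; _≤?_; _<?_; _≟_; z≤n; s≤s)
open import Data.Nat.Divisibility using (divides; ∣m∣n⇒∣m+n; ∣m+n∣m⇒∣n; n∣n; m∣m*n; ∣m⇒∣m*n)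
open import Data.Nat.ListAction using (sum)
open import Data.Nat.ListAction.Properties using (sum-++)
open import Data.Nat.Properties
open import Data.Nat.Tactic.RingSolver using (solve-∀)
open import Data.Product using (_×_; _,_; proj₁; proj₂)
open import Data.Sum using (_⊎_; inj₁; inj₂)
open import Function using (_∘_; case_of_)
open import Relation.Binary.PropositionalEquality
open import Relation.Nullary using (¬_; yes; no)
open import Relation.Unary using (Decidable)

open import Defs

+-interchange : ∀ a b c d → (a + b) + (c + d) ≡ (a + c) + (b + d)
+-interchange = interchange +-commutativeSemigroup

-- Partial sums and transposes

psum : ℕ → List ℕ → ℕ
psum j L = sum (take j L)

capSum : ℕ → List ℕ → ℕ
capSum j L = sum (map (_⊓ j) L)

-- the (n+1)-st part, 0 beyond the end
part : ℕ → List ℕ → ℕ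
part _       []       = 0
part zero    (x ∷ _)  = x
part (suc n) (_ ∷ xs) = part n xs

psum-suc : ∀ n L → psum (suc n) L ≡ psum n L + part n L
psum-suc zero    []       = refl
psum-suc (suc n) []       = refl
psum-suc zero    (x ∷ xs) = +-identityʳ x
psum-suc (suc n) (x ∷ xs) = trans (cong (x +_) (psum-suc n xs)) (sym (+-assoc x _ _))

psum-addP : ∀ j p q → psum j (addP p q) ≡ psum j p + psum j q
psum-addP zero    p        q        = refl
psum-addP (suc j) []       q        = refl
psum-addP (suc j) (x ∷ xs) []       = sym (+-identityʳ _)
psum-addP (suc j) (x ∷ xs) (y ∷ ys) =
  trans (cong (x + y +_) (psum-addP j xs ys)) (+-interchange x y (psum j xs) (psum j ys))

sum-addP : ∀ p q → sum (addP p q) ≡ sum p + sum q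
sum-addP []       q        = refl
sum-addP (x ∷ xs) []       = sym (+-identityʳ _)
sum-addP (x ∷ xs) (y ∷ ys) =
  trans (cong (x + y +_) (sum-addP xs ys)) (+-interchange x y (sum xs) (sum ys))

dom-trans : ∀ {p q s} → Dom p q → Dom q s → Dom p s
dom-trans p≤q q≤s j = ≤-trans (p≤q j) (q≤s j)

countGe-∷-≤ : ∀ {i x} xs → i ≤ x → countGe i (x ∷ xs) ≡ suc (countGe i xs)
countGe-∷-≤ {i} xs i≤x = cong length (filter-accept (i ≤?_) i≤x)

countGe-∷-≰ : ∀ {i x} xs → ¬ i ≤ x → countGe i (x ∷ xs) ≡ countGe i xs
countGe-∷-≰ {i} xs i≰x = cong length (filter-reject (i ≤?_) i≰x)

countGe-suc-≤ : ∀ n L → countGe (suc n) L ≤ countGe n L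
countGe-suc-≤ n []       = z≤n
countGe-suc-≤ n (x ∷ xs) with suc n ≤? x | n ≤? x
... | yes n<x | _       rewrite countGe-∷-≤ xs n<x | countGe-∷-≤ xs (<⇒≤ n<x) =
  s≤s (countGe-suc-≤ n xs)
... | no  n≮x | yes n≤x rewrite countGe-∷-≰ xs n≮x | countGe-∷-≤ xs n≤x =
  m≤n⇒m≤1+n (countGe-suc-≤ n xs)
... | no  n≮x | no  n≰x rewrite countGe-∷-≰ xs n≮x | countGe-∷-≰ xs n≰x =
  countGe-suc-≤ n xs

countGe-all-< : ∀ {i} L → All (_< i) L → countGe i L ≡ 0
countGe-all-< []       []           = refl
countGe-all-< (x ∷ xs) (x<i ∷ xs<i) = trans (countGe-∷-≰ xs (<⇒≱ x<i)) (countGe-all-< xs xs<i)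

countGe-all-≥ : ∀ {i} L → All (i ≤_) L → countGe i L ≡ length L
countGe-all-≥ []       []           = refl
countGe-all-≥ (x ∷ xs) (i≤x ∷ i≤xs) = trans (countGe-∷-≤ xs i≤x) (cong suc (countGe-all-≥ xs i≤xs))

countGe-++ : ∀ i p q → countGe i (p ++ q) ≡ countGe i p + countGe i q
countGe-++ i p q = trans (cong length (filter-++ (i ≤?_) p q)) (length-++ (filter (i ≤?_) p))

xs≤maxPart : ∀ L → All (_≤ maxPart L) L
xs≤maxPart []       = []
xs≤maxPart (x ∷ xs) =
  m≤m⊔n x (maxPart xs) ∷ All.map (λ y≤max → ≤-trans y≤max (m≤n⊔m x (maxPart xs))) (xs≤maxPart xs)

capSum-zero : ∀ L → capSum 0 L ≡ 0
capSum-zero []       = refl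
capSum-zero (x ∷ xs) = trans (cong (_+ capSum 0 xs) (⊓-zeroʳ x)) (capSum-zero xs)

capSum-suc : ∀ n L → capSum (suc n) L ≡ capSum n L + countGe (suc n) L
capSum-suc n []       = refl
capSum-suc n (x ∷ xs) with suc n ≤? x
... | yes n<x rewrite countGe-∷-≤ xs n<x | m≥n⇒m⊓n≡n n<x | m≥n⇒m⊓n≡n (<⇒≤ n<x) | capSum-suc n xs =
  sym (trans (+-suc _ _) (cong suc (+-assoc n _ _)))
... | no  n≮x rewrite countGe-∷-≰ xs n≮x | m≤n⇒m⊓n≡m (≤-pred (≰⇒> n≮x)) | m≤n⇒m⊓n≡m (<⇒≤ (≰⇒> n≮x))
                    | capSum-suc n xs =
  sym (+-assoc x _ _)

capSum-all-≤ : ∀ {j} L → All (_≤ j) L → capSum j L ≡ sum L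
capSum-all-≤ []       []           = refl
capSum-all-≤ (x ∷ xs) (x≤j ∷ xs≤j) = cong₂ _+_ (m≤n⇒m⊓n≡m x≤j) (capSum-all-≤ xs xs≤j)

capSum-all-≥ : ∀ {j} L → All (j ≤_) L → capSum j L ≡ length L * j
capSum-all-≥ []       []           = refl
capSum-all-≥ (x ∷ xs) (j≤x ∷ j≤xs) = cong₂ _+_ (m≥n⇒m⊓n≡n j≤x) (capSum-all-≥ xs j≤xs)

capSum-++ : ∀ j p q → capSum j (p ++ q) ≡ capSum j p + capSum j q
capSum-++ j p q = trans (cong sum (map-++ (_⊓ j) p q)) (sum-++ (map (_⊓ j) p) _)

transpose-applyUpTo : ∀ q → transpose q ≡ applyUpTo (λ i → countGe (suc i) q) (maxPart q)
transpose-applyUpTo q = map-upTo (λ i → countGe (suc i) q) (maxPart q)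

part-applyUpTo : ∀ (f : ℕ → ℕ) {j n} → j < n → part j (applyUpTo f n) ≡ f j
part-applyUpTo f {zero}  {suc n} _         = refl
part-applyUpTo f {suc j} {suc n} (s≤s j<n) = part-applyUpTo (f ∘ suc) j<n

part-beyond : ∀ {j} L → length L ≤ j → part j L ≡ 0
part-beyond {j}     []       _           = refl
part-beyond {suc j} (x ∷ xs) (s≤s len≤j) = part-beyond xs len≤j

part-transpose : ∀ j q → part j (transpose q) ≡ countGe (suc j) q
part-transpose j q rewrite transpose-applyUpTo q with j <? maxPart q
... | yes j<max = part-applyUpTo _ j<max
... | no  j≮max = trans (part-beyond (applyUpTo f (maxPart q)) length≤j) (sym (countGe-all-< q parts≤j))
  where
  f : ℕ → ℕ
  f i = countGe (suc i) q
  length≤j : length (applyUpTo f (maxPart q)) ≤ j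
  length≤j = ≤-trans (≤-reflexive (length-applyUpTo f (maxPart q))) (≮⇒≥ j≮max)
  parts≤j : All (_< suc j) q
  parts≤j = All.map (λ x≤max → s≤s (≤-trans x≤max (≮⇒≥ j≮max))) (xs≤maxPart q)

psum-transpose-suc : ∀ j q → psum (suc j) (transpose q) ≡ psum j (transpose q) + countGe (suc j) q
psum-transpose-suc j q = trans (psum-suc j (transpose q)) (cong (psum j (transpose q) +_) (part-transpose j q))

psum-transpose : ∀ j q → psum j (transpose q) ≡ capSum j q
psum-transpose zero    q = sym (capSum-zero q)
psum-transpose (suc j) q = begin
  psum (suc j) (transpose q)               ≡⟨ psum-transpose-suc j q ⟩
  psum j (transpose q) + countGe (suc j) q ≡⟨ cong (_+ countGe (suc j) q) (psum-transpose j q) ⟩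
  capSum j q + countGe (suc j) q           ≡⟨ capSum-suc j q ⟨
  capSum (suc j) q                         ∎
  where open ≡-Reasoning

sum-transpose : ∀ q → sum (transpose q) ≡ sum q
sum-transpose q = begin
  sum (transpose q)              ≡⟨ cong sum (take-all (maxPart q) (transpose q) length≤max) ⟨
  psum (maxPart q) (transpose q) ≡⟨ psum-transpose (maxPart q) q ⟩
  capSum (maxPart q) q           ≡⟨ capSum-all-≤ q (xs≤maxPart q) ⟩
  sum q                          ∎
  where
  open ≡-Reasoning
  length≤max : length (transpose q) ≤ maxPart q
  length≤max = ≤-reflexive (trans (cong length (transpose-applyUpTo q)) (length-applyUpTo _ _))

countGe-pos : ∀ n L → n < maxPart L → 0 < countGe (suc n) L
countGe-pos n []       ()
countGe-pos n (x ∷ xs) n<max with suc n ≤? x | ⊔-sel x (maxPart xs)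
... | yes n<x | _          = ≤-trans (s≤s z≤n) (≤-reflexive (sym (countGe-∷-≤ xs n<x)))
... | no  n≮x | inj₁ max≡x = ⊥-elim (n≮x (≤-trans n<max (≤-reflexive max≡x)))
... | no  n≮x | inj₂ max≡m =
  ≤-trans (countGe-pos n xs (≤-trans n<max (≤-reflexive max≡m))) (≤-reflexive (sym (countGe-∷-≰ xs n≮x)))

transpose-isPartition : ∀ q → IsPartition (transpose q)
transpose-isPartition q rewrite transpose-applyUpTo q =
  Linkedₚ.applyUpTo⁺₂ _ (maxPart q) (λ i → countGe-suc-≤ (suc i) q) ,
  Allₚ.applyUpTo⁺₁ _ (maxPart q) (countGe-pos _ q)

length-filter-doubled : ∀ {P : ℕ → Set} (P? : Decidable P) as →
  length (filter P? (doubled as)) ≡ length (filter P? as) + length (filter P? as)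
length-filter-doubled P? []       = refl
length-filter-doubled P? (a ∷ as) with P? a in eq
... | yes _ rewrite eq = cong suc (trans (cong suc (length-filter-doubled P? as)) (sym (+-suc _ _)))
... | no  _ rewrite eq = length-filter-doubled P? as

countGe-doubled : ∀ i as → countGe i (doubled as) ≡ countGe i as + countGe i as
countGe-doubled i = length-filter-doubled (i ≤?_)

mult-doubled : ∀ v as → mult v (doubled as) ≡ mult v as + mult v as
mult-doubled v = length-filter-doubled (_≟ v)

+-double-interchange : ∀ x y → x + (x + (y + y)) ≡ (x + y) + (x + y)
+-double-interchange x y = trans (sym (+-assoc x x (y + y))) (+-interchange x x y y)

sum-doubled : ∀ as → sum (doubled as) ≡ sum as + sum as
sum-doubled []       = refl
sum-doubled (a ∷ as) = trans (cong (λ s → a + (a + s)) (sum-doubled as)) (+-double-interchange a (sum as))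

capSum-doubled : ∀ j as → capSum j (doubled as) ≡ capSum j as + capSum j as
capSum-doubled j []       = refl
capSum-doubled j (a ∷ as) =
  trans (cong (λ s → a ⊓ j + (a ⊓ j + s)) (capSum-doubled j as)) (+-double-interchange (a ⊓ j) (capSum j as))

parity : ℕ → Bool
parity zero    = false
parity (suc n) = not (parity n)

parity-+ : ∀ m n → parity (m + n) ≡ parity m xor parity n
parity-+ zero    n = refl
parity-+ (suc m) n = trans (cong not (parity-+ m n)) (not-distribˡ-xor (parity m) (parity n))

parity-*2 : ∀ q → parity (q * 2) ≡ false
parity-*2 zero    = refl
parity-*2 (suc q) = trans (not-involutive (parity (q * 2))) (parity-*2 q)

even⇒parity≡false : ∀ {n} → Even n → parity n ≡ false
even⇒parity≡false (divides q refl) = parity-*2 q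

parity≡false⇒even : ∀ n → parity n ≡ false → Even n
parity≡false⇒even zero          _ = divides 0 refl
parity≡false⇒even (suc zero)    ()
parity≡false⇒even (suc (suc n)) p =
  ∣m∣n⇒∣m+n n∣n (parity≡false⇒even n (trans (sym (not-involutive (parity n))) p))

¬even⇒parity≡true : ∀ n → ¬ Even n → parity n ≡ true
¬even⇒parity≡true n odd-n = ¬-not (odd-n ∘ parity≡false⇒even n)

even-double : ∀ n → Even (n + n)
even-double n = divides n (trans (cong (n +_) (sym (+-identityʳ n))) (*-comm 2 n))

even⇒¬even-suc : ∀ {n} → Even n → ¬ Even (suc n)
even⇒¬even-suc even-n even-sn =
  case trans (sym (cong not (even⇒parity≡false even-n))) (even⇒parity≡false even-sn) of λ ()

¬even-1 : ¬ Even 1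
¬even-1 = even⇒¬even-suc (divides 0 refl)

even-2+⇒even : ∀ {n} → Even (2 + n) → Even n
even-2+⇒even even-2+n = ∣m+n∣m⇒∣n even-2+n n∣n

¬even-+ˡ : ∀ {c n} → Even c → ¬ Even n → ¬ Even (c + n)
¬even-+ˡ even-c odd-n even-cn = odd-n (∣m+n∣m⇒∣n even-cn even-c)

-- Orthogonal partitions

mult-∷-≡ : ∀ {v} xs → mult v (v ∷ xs) ≡ suc (mult v xs)
mult-∷-≡ {v} xs = cong length (filter-accept (_≟ v) refl)

mult-∷-≢ : ∀ {v x} xs → x ≢ v → mult v (x ∷ xs) ≡ mult v xs
mult-∷-≢ {v} xs x≢v = cong length (filter-reject (_≟ v) x≢v)

mult-all-< : ∀ {v} r → All (_< v) r → mult v r ≡ 0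
mult-all-< []       []           = refl
mult-all-< (x ∷ xs) (x<v ∷ xs<v) = trans (mult-∷-≢ xs (<⇒≢ x<v)) (mult-all-< xs xs<v)

≥-linked⇒≤head : ∀ {x xs} → Linked _≥_ (x ∷ xs) → All (_≤ x) (x ∷ xs)
≥-linked⇒≤head = Linked⇒All (λ y≥x z≤x → ≤-trans z≤x y≥x) ≤-refl

OrthExcept : ℕ → List ℕ → Set
OrthExcept y r = ∀ v → Even v → v ≢ y → Even (mult v r)

-- psum j r + j has the parity of the number of even parts among the first j, so it is odd only when the
-- prefix ends inside a block of equal even parts. When scanning y ∷ r, openRun y r tracks the block of y's
-- already entered: it is open when y is even and r still holds an odd number of y's.
openRun : ℕ → List ℕ → Bool
openRun y r = not (parity y) ∧ parity (mult y r)

openRun-below : ∀ {x y} rest → x < y → Linked _≥_ (x ∷ rest) → openRun y (x ∷ rest) ≡ false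
openRun-below {x} {y} rest x<y lnk = begin
  not (parity y) ∧ parity (mult y (x ∷ rest)) ≡⟨ cong (λ m → not (parity y) ∧ parity m) (mult-all-< (x ∷ rest) r<y) ⟩
  not (parity y) ∧ false                       ≡⟨ ∧-zeroʳ (not (parity y)) ⟩
  false                                        ∎
  where
  open ≡-Reasoning
  r<y : All (_< y) (x ∷ rest)
  r<y = All.map (λ z≤x → ≤-<-trans z≤x x<y) (≥-linked⇒≤head lnk)

openRun-step : ∀ {x y} rest → x ≤ y → Linked _≥_ (x ∷ rest) → OrthExcept y (x ∷ rest) →
  not (parity x) xor openRun y (x ∷ rest) ≡ openRun x rest
openRun-step {x} {y} rest x≤y lnk orth with x ≟ y
... | yes refl rewrite mult-∷-≡ {x} rest = absorb (not (parity x)) (parity (mult x rest))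
  where
  absorb : ∀ a b → a xor (a ∧ not b) ≡ a ∧ b
  absorb false b     = refl
  absorb true  true  = refl
  absorb true  false = refl
... | no  x≢y rewrite openRun-below rest (≤∧≢⇒< x≤y x≢y) lnk =
  trans (xor-identityʳ (not (parity x))) (x-block-odd (parity x) refl)
  where
  x-block-odd : ∀ b → parity x ≡ b → not b ≡ not b ∧ parity (mult x rest)
  x-block-odd true  _  = refl
  x-block-odd false px = sym (not-injective (trans (sym (cong parity (mult-∷-≡ {x} rest)))
    (even⇒parity≡false (orth x (parity≡false⇒even x px) x≢y))))

orthExcept-plateau : ∀ y r → Linked _≥_ (y ∷ r) → OrthExcept y r →
  ∀ j → parity (psum j r + j) xor openRun y r ≡ true →
  part j (y ∷ r) ≡ part (suc j) (y ∷ r) × Even (part j (y ∷ r))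
orthExcept-plateau y []         _           _    zero    odd = case trans (sym (∧-zeroʳ (not (parity y)))) odd of λ ()
orthExcept-plateau y []         _           _    (suc j) _   = refl , divides 0 refl
orthExcept-plateau y (x ∷ rest) (x≤y ∷ lnk) orth zero    odd with x ≟ y
... | yes refl = refl , parity≡false⇒even y (not-injective (∧-conicalˡ _ _ odd))
... | no  x≢y  = case trans (sym (openRun-below rest (≤∧≢⇒< x≤y x≢y) lnk)) odd of λ ()
orthExcept-plateau y (x ∷ rest) (x≤y ∷ lnk) orth (suc j) odd =
  orthExcept-plateau x rest lnk orth-rest j odd-rest
  where
  orth-rest : OrthExcept x rest
  orth-rest v even-v v≢x with v ≟ y
  ... | yes refl = subst Even (sym (mult-all-< rest rest<v)) (divides 0 refl)
    where
    rest<v : All (_< v) rest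
    rest<v = All.map (λ z≤x → ≤-<-trans z≤x (≤∧≢⇒< x≤y (v≢x ∘ sym))) (All.tail (≥-linked⇒≤head lnk))
  ... | no  v≢y  = subst Even (mult-∷-≢ rest (v≢x ∘ sym)) (orth v even-v v≢y)
  p : ℕ
  p = psum j rest
  a b c : Bool
  a = not (parity x)
  b = parity (p + j)
  c = openRun y (x ∷ rest)
  odd-rest : b xor openRun x rest ≡ true
  odd-rest = begin
    b xor openRun x rest           ≡⟨ cong (b xor_) (openRun-step rest x≤y lnk orth) ⟨
    b xor (a xor c)                ≡⟨ xor-assoc b a c ⟨
    (b xor a) xor c                ≡⟨ cong (_xor c) (xor-comm b a) ⟩
    (a xor b) xor c                ≡⟨ cong (_xor c) (parity-+ (suc x) (p + j)) ⟨
    parity (suc x + (p + j)) xor c ≡⟨ cong (λ n → parity n xor c) shift ⟩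
    parity (x + p + suc j) xor c   ≡⟨ odd ⟩
    true                           ∎
    where
    open ≡-Reasoning
    shift : suc x + (p + j) ≡ x + p + suc j
    shift = sym (trans (+-suc (x + p) j) (cong suc (+-assoc x p j)))

orth⇒openRun≡false : ∀ {r} → Orth r → ∀ y → openRun y r ≡ false
orth⇒openRun≡false orth y with parity y in py
... | true  = refl
... | false = even⇒parity≡false (orth y (parity≡false⇒even y py))

maxPart-∷-linked : ∀ {r} → Linked _≥_ r → Linked _≥_ (maxPart r ∷ r)
maxPart-∷-linked {[]}     []  = [-]
maxPart-∷-linked {x ∷ xs} lnk = m≤m⊔n x (maxPart xs) ∷ lnk

orth-plateau : ∀ {r} → Linked _≥_ r → Orth r → ∀ j → ¬ Even (psum (suc j) r + suc j) →
  part j r ≡ part (suc j) r × Even (part j r)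
orth-plateau {r} lnk orth j odd =
  orthExcept-plateau (maxPart r) r (maxPart-∷-linked lnk) (λ v even-v _ → orth v even-v) (suc j)
    (cong₂ _xor_ (¬even⇒parity≡true _ odd) (orth⇒openRun≡false {r} orth (maxPart r)))

-- the common part c = r_{j+1} = r_{j+2} is squeezed between the (j+1)-st and (j+2)-nd parts of Lᵗ
orth-touch-transpose : ∀ L {r} → Linked _≥_ r → Orth r → Dom r (transpose L) → ∀ j →
  psum (suc j) r ≡ psum (suc j) (transpose L) → ¬ Even (psum (suc j) r + suc j) →
  countGe (suc j) L ≡ countGe (suc (suc j)) L × Even (countGe (suc j) L)
orth-touch-transpose L {r} lnk orth dom j touch odd =
  ≤-antisym (≤-trans κ≤c c≤κ′) (countGe-suc-≤ (suc j) L) , subst Even (≤-antisym c≤κ κ≤c) (proj₂ plateau)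
  where
  t : List ℕ
  t = transpose L
  κ κ′ c : ℕ
  κ  = countGe (suc j) L
  κ′ = countGe (suc (suc j)) L
  c  = part j r
  plateau : c ≡ part (suc j) r × Even c
  plateau = orth-plateau lnk orth j odd
  κ≤c : κ ≤ c
  κ≤c = +-cancelˡ-≤ (psum j t) κ c (begin
    psum j t + κ   ≡⟨ psum-transpose-suc j L ⟨
    psum (suc j) t ≡⟨ touch ⟨
    psum (suc j) r ≡⟨ psum-suc j r ⟩
    psum j r + c   ≤⟨ +-monoˡ-≤ c (dom j) ⟩
    psum j t + c   ∎)
    where open ≤-Reasoning
  c≤κ′ : c ≤ κ′
  c≤κ′ = +-cancelˡ-≤ (psum (suc j) t) c κ′ (begin
    psum (suc j) t + c              ≡⟨ cong₂ _+_ touch (sym (proj₁ plateau)) ⟨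
    psum (suc j) r + part (suc j) r ≡⟨ psum-suc (suc j) r ⟨
    psum (suc (suc j)) r            ≤⟨ dom (suc (suc j)) ⟩
    psum (suc (suc j)) t            ≡⟨ psum-transpose-suc (suc j) L ⟩
    psum (suc j) t + κ′             ∎)
    where open ≤-Reasoning
  c≤κ : c ≤ κ
  c≤κ = ≤-trans c≤κ′ (countGe-suc-≤ (suc j) L)

applyUpTo-doubled : ∀ (f g : ℕ → ℕ) n →
  (∀ i → f (2 * i) ≡ g i) → (∀ i → f (suc (2 * i)) ≡ g i) →
  applyUpTo f (2 * n) ≡ doubled (applyUpTo g n)
applyUpTo-doubled f g zero    _   _     = refl
applyUpTo-doubled f g (suc n) f2i f2i+1 = begin
  applyUpTo f (2 * suc n)                       ≡⟨ cong (applyUpTo f) (*-suc 2 n) ⟩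
  f 0 ∷ f 1 ∷ applyUpTo (f ∘ suc ∘ suc) (2 * n) ≡⟨ cong₂ (λ u v → u ∷ v ∷ _) (f2i 0) (f2i+1 0) ⟩
  g 0 ∷ g 0 ∷ applyUpTo (f ∘ suc ∘ suc) (2 * n) ≡⟨ cong (λ l → g 0 ∷ g 0 ∷ l) ih ⟩
  doubled (applyUpTo g (suc n))                 ∎
  where
  open ≡-Reasoning
  ih : applyUpTo (f ∘ suc ∘ suc) (2 * n) ≡ doubled (applyUpTo (g ∘ suc) n)
  ih = applyUpTo-doubled (f ∘ suc ∘ suc) (g ∘ suc) n
         (λ i → trans (cong f (sym (*-suc 2 i))) (f2i (suc i)))
         (λ i → trans (cong (f ∘ suc) (sym (*-suc 2 i))) (f2i+1 (suc i)))

countGe-map : ∀ (f : ℕ → ℕ) {i k} q → (∀ a → i ≤ f a → k ≤ a) → (∀ a → k ≤ a → i ≤ f a) →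
  countGe i (map f q) ≡ countGe k q
countGe-map f []      _  _    = refl
countGe-map f {k = k} (a ∷ q) to from with k ≤? a
... | yes k≤a = trans (countGe-∷-≤ (map f q) (from a k≤a))
                      (trans (cong suc (countGe-map f q to from)) (sym (countGe-∷-≤ q k≤a)))
... | no  k≰a = trans (countGe-∷-≰ (map f q) (k≰a ∘ to a))
                      (trans (countGe-map f q to from) (sym (countGe-∷-≰ q k≰a)))

maxPart-double : ∀ q → maxPart (map (2 *_) q) ≡ 2 * maxPart q
maxPart-double []      = refl
maxPart-double (a ∷ q) = trans (cong (2 * a ⊔_) (maxPart-double q)) (sym (*-distribˡ-⊔ 2 a (maxPart q)))

transpose-double : ∀ q → transpose (map (2 *_) q) ≡ doubled (transpose q)
transpose-double q = begin
  transpose (map (2 *_) q)             ≡⟨ transpose-applyUpTo (map (2 *_) q) ⟩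
  applyUpTo f (maxPart (map (2 *_) q)) ≡⟨ cong (applyUpTo f) (maxPart-double q) ⟩
  applyUpTo f (2 * maxPart q)          ≡⟨ applyUpTo-doubled f g (maxPart q) at-2i at-2i+1 ⟩
  doubled (applyUpTo g (maxPart q))    ≡⟨ cong doubled (transpose-applyUpTo q) ⟨
  doubled (transpose q)                ∎
  where
  open ≡-Reasoning
  f g : ℕ → ℕ
  f i = countGe (suc i) (map (2 *_) q)
  g i = countGe (suc i) q
  at-2i : ∀ i → f (2 * i) ≡ g i
  at-2i i = countGe-map (2 *_) q
    (λ a 2i<2a → *-cancelˡ-< 2 i a 2i<2a)
    (λ a i<a → ≤-trans (n≤1+n (suc (2 * i))) (≤-trans (≤-reflexive (sym (*-suc 2 i))) (*-monoʳ-≤ 2 i<a)))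
  at-2i+1 : ∀ i → f (suc (2 * i)) ≡ g i
  at-2i+1 i = countGe-map (2 *_) q
    (λ a 2i+2≤2a → *-cancelˡ-≤ 2 (≤-trans (≤-reflexive (*-suc 2 i)) 2i+2≤2a))
    (λ a i<a → ≤-trans (≤-reflexive (sym (*-suc 2 i))) (*-monoʳ-≤ 2 i<a))

doubled-orth : ∀ L → Orth (doubled L)
doubled-orth L v _ = subst Even (sym (mult-doubled v L)) (even-double (mult v L))

transpose-double-orth : ∀ q → Orth (transpose (map (2 *_) q))
transpose-double-orth q = subst Orth (sym (transpose-double q)) (doubled-orth (transpose q))

-- Re-pairing the odd parts

raisePairs : List ℕ → List ℕ
raisePairs (a ∷ b ∷ ms) = a ∷ suc b ∷ raisePairs ms
raisePairs _            = []

-- [m₁ m₂ m₃ m₄ ⋯] ↦ [2m₁ (2m₂+2) 2m₃ (2m₄+2) ⋯], the same total as [(2m₁+1) (2m₂+1) ⋯] when l is even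
pairedEvenParts : List ℕ → List ℕ
pairedEvenParts ms = map (2 *_) (raisePairs ms)

raisePairs-all : ∀ {P : ℕ → Set} → (∀ {m} → P m → P (suc m)) → ∀ {ms} → All P ms → All P (raisePairs ms)
raisePairs-all up []             = []
raisePairs-all up (_ ∷ [])       = []
raisePairs-all up (pa ∷ pb ∷ ps) = pa ∷ up pb ∷ raisePairs-all up ps

length-pairedEvenParts : ∀ ms → Even (length ms) → length (pairedEvenParts ms) ≡ length (oddParts ms)
length-pairedEvenParts []           _        = refl
length-pairedEvenParts (a ∷ [])     even-len = ⊥-elim (¬even-1 even-len)
length-pairedEvenParts (a ∷ b ∷ ms) even-len =
  cong (suc ∘ suc) (length-pairedEvenParts ms (even-2+⇒even even-len))

sum-pairedEvenParts : ∀ ms → Even (length ms) → sum (pairedEvenParts ms) ≡ sum (oddParts ms)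
sum-pairedEvenParts []           _        = refl
sum-pairedEvenParts (a ∷ [])     even-len = ⊥-elim (¬even-1 even-len)
sum-pairedEvenParts (a ∷ b ∷ ms) even-len =
  trans (cong (λ s → 2 * a + (2 * suc b + s)) (sum-pairedEvenParts ms (even-2+⇒even even-len)))
        (regroup a b (sum (oddParts ms)))
  where
  regroup : ∀ a b s → 2 * a + (2 * suc b + s) ≡ 2 * a + 1 + (2 * b + 1 + s)
  regroup = solve-∀

Balanced : ℕ → ℕ → ℕ → ℕ → Set
Balanced o x g g′ = o ≡ x × Even o × g ≡ g′ × Even g

Excess : ℕ → ℕ → ℕ → ℕ → ℕ → Set
Excess j o x g g′ = o ≡ suc x × ¬ Even (o + j) × ¬ (g ≡ g′ × Even g)

-- ExcessAt j holds exactly when 2m₂ᵢ₋₁ < j ≤ 2m₂ᵢ + 1 for some i, and BalancedAt j otherwise.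
BalancedAt ExcessAt PairingDefect : ℕ → List ℕ → Set
BalancedAt j ms = Balanced (capSum j (oddParts ms)) (capSum j (pairedEvenParts ms))
                           (countGe j (oddParts ms)) (countGe (suc j) (oddParts ms))
ExcessAt j ms = Excess j (capSum j (oddParts ms)) (capSum j (pairedEvenParts ms))
                         (countGe j (oddParts ms)) (countGe (suc j) (oddParts ms))
PairingDefect j ms = BalancedAt j ms ⊎ ExcessAt j ms

defect-shift : ∀ {j C c o x g g′ o₁ x₁ g₁ g₁′} → Even C → Even c →
  o₁ ≡ C + o → x₁ ≡ C + x → g₁ ≡ c + g → g₁′ ≡ c + g′ →
  Balanced o x g g′ ⊎ Excess j o x g g′ → Balanced o₁ x₁ g₁ g₁′ ⊎ Excess j o₁ x₁ g₁ g₁′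
defect-shift {C = C} {c} even-C even-c refl refl refl refl (inj₁ (o≡x , even-o , g≡g′ , even-g)) =
  inj₁ (cong (C +_) o≡x , ∣m∣n⇒∣m+n even-C even-o , cong (c +_) g≡g′ , ∣m∣n⇒∣m+n even-c even-g)
defect-shift {j} {C} {c} {o} {x} even-C even-c refl refl refl refl (inj₂ (o≡1+x , odd , not-flat)) =
  inj₂ (trans (cong (C +_) o≡1+x) (+-suc C x) ,
        ¬even-+ˡ even-C odd ∘ subst Even (+-assoc C o j) ,
        λ (g≡g′ , even-g) → not-flat (+-cancelˡ-≡ c _ _ g≡g′ , ∣m+n∣m⇒∣n even-g even-c))

pairs-above-balanced : ∀ {j} ms → Even (length ms) → All (λ m → j ≤ 2 * m) ms → BalancedAt j ms
pairs-above-balanced {j} ms even-len above =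
  trans o≡ (sym x≡) ,
  subst Even (sym o≡) (∣m⇒∣m*n j even-n) ,
  trans (countGe-all-≥ _ odd≥j) (sym (countGe-all-≥ _ odd>j)) ,
  subst Even (sym (countGe-all-≥ _ odd≥j)) even-n
  where
  n : ℕ
  n = length (oddParts ms)
  even-n : Even n
  even-n = subst Even (sym (length-map _ ms)) even-len
  odd≥j : All (j ≤_) (oddParts ms)
  odd≥j = Allₚ.map⁺ (All.map (λ j≤2m → ≤-trans j≤2m (m≤m+n _ 1)) above)
  odd>j : All (suc j ≤_) (oddParts ms)
  odd>j = Allₚ.map⁺ (All.map (λ j≤2m → ≤-trans (s≤s j≤2m) (≤-reflexive (+-comm 1 _))) above)
  even≥j : All (j ≤_) (pairedEvenParts ms)
  even≥j = Allₚ.map⁺ (raisePairs-all (λ j≤2m → ≤-trans j≤2m (*-monoʳ-≤ 2 (n≤1+n _))) above)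
  o≡ : capSum j (oddParts ms) ≡ n * j
  o≡ = capSum-all-≥ _ odd≥j
  x≡ : capSum j (pairedEvenParts ms) ≡ n * j
  x≡ = trans (capSum-all-≥ _ even≥j) (cong (_* j) (length-pairedEvenParts ms even-len))

<-linked⇒head< : ∀ {x xs} → Linked _<_ (x ∷ xs) → All (x <_) xs
<-linked⇒head< [-]         = []
<-linked⇒head< (x<y ∷ lnk) = Linked⇒All <-trans x<y lnk

2m+1≡1+2m : ∀ m → 2 * m + 1 ≡ suc (2 * m)
2m+1≡1+2m m = +-comm (2 * m) 1

2m+1≤2[1+m] : ∀ m → 2 * m + 1 ≤ 2 * suc m
2m+1≤2[1+m] m = ≤-trans (≤-reflexive (2m+1≡1+2m m)) (≤-trans (n≤1+n _) (≤-reflexive (sym (*-suc 2 m))))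

straddling-pair-counts : ∀ {j a b} ms → 2 * a < j → j ≤ 2 * b + 1 → a < b →
  countGe j (oddParts ms) ≡ countGe (suc j) (oddParts ms) → Even (countGe j (oddParts ms)) →
  ¬ (countGe j (oddParts (a ∷ b ∷ ms)) ≡ countGe (suc j) (oddParts (a ∷ b ∷ ms))
     × Even (countGe j (oddParts (a ∷ b ∷ ms))))
straddling-pair-counts {j} {a} {b} ms 2a<j j≤2b+1 a<b g≡g′ even-g with j ≤? 2 * a + 1
... | yes j≤2a+1 = λ (flat , _) → 1+n≢n (trans (suc-injective (trans (sym g-full) (trans flat g′-full))) (sym g≡g′))
  where
  sj≰2a+1 : ¬ suc j ≤ 2 * a + 1
  sj≰2a+1 sj≤2a+1 = <⇒≱ 2a<j (≤-pred (≤-trans sj≤2a+1 (≤-reflexive (2m+1≡1+2m a))))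
  sj≤2b+1 : suc j ≤ 2 * b + 1
  sj≤2b+1 = ≤-trans (s≤s j≤2a+1) (≤-trans (≤-reflexive (trans (cong suc (2m+1≡1+2m a)) (sym (*-suc 2 a))))
                                          (≤-trans (*-monoʳ-≤ 2 a<b) (m≤m+n _ 1)))
  g-full : countGe j (oddParts (a ∷ b ∷ ms)) ≡ suc (suc (countGe j (oddParts ms)))
  g-full = trans (countGe-∷-≤ _ j≤2a+1) (cong suc (countGe-∷-≤ (oddParts ms) j≤2b+1))
  g′-full : countGe (suc j) (oddParts (a ∷ b ∷ ms)) ≡ suc (countGe (suc j) (oddParts ms))
  g′-full = trans (countGe-∷-≰ _ sj≰2a+1) (countGe-∷-≤ (oddParts ms) sj≤2b+1)
... | no  j≰2a+1 = λ (_ , even-g-full) → even⇒¬even-suc even-g (subst Even g-full even-g-full)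
  where
  g-full : countGe j (oddParts (a ∷ b ∷ ms)) ≡ suc (countGe j (oddParts ms))
  g-full = trans (countGe-∷-≰ _ j≰2a+1) (countGe-∷-≤ (oddParts ms) j≤2b+1)

straddling-pair-excess : ∀ {j a b} ms → 2 * a < j → j ≤ 2 * b + 1 → a < b →
  BalancedAt j ms → ExcessAt j (a ∷ b ∷ ms)
straddling-pair-excess {j} {a} {b} ms 2a<j j≤2b+1 a<b (o≡x , even-o , g≡g′ , even-g) =
  o-full≡1+x-full , odd , straddling-pair-counts ms 2a<j j≤2b+1 a<b g≡g′ even-g
  where
  o x : ℕ
  o = capSum j (oddParts ms)
  x = capSum j (pairedEvenParts ms)
  o-split : capSum j (oddParts (a ∷ b ∷ ms)) ≡ 2 * a + 1 + (j + o)
  o-split = cong₂ (λ u v → u + (v + o))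
    (m≤n⇒m⊓n≡m (≤-trans (≤-reflexive (2m+1≡1+2m a)) 2a<j)) (m≥n⇒m⊓n≡n j≤2b+1)
  x-split : capSum j (pairedEvenParts (a ∷ b ∷ ms)) ≡ 2 * a + (j + x)
  x-split = cong₂ (λ u v → u + (v + x))
    (m≤n⇒m⊓n≡m (<⇒≤ 2a<j)) (m≥n⇒m⊓n≡n (≤-trans j≤2b+1 (2m+1≤2[1+m] b)))
  o-full≡1+x-full : capSum j (oddParts (a ∷ b ∷ ms)) ≡ suc (capSum j (pairedEvenParts (a ∷ b ∷ ms)))
  o-full≡1+x-full = begin
    capSum j (oddParts (a ∷ b ∷ ms))              ≡⟨ o-split ⟩
    2 * a + 1 + (j + o)                           ≡⟨ cong (λ y → 2 * a + 1 + (j + y)) o≡x ⟩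
    2 * a + 1 + (j + x)                           ≡⟨ cong (_+ (j + x)) (2m+1≡1+2m a) ⟩
    suc (2 * a + (j + x))                         ≡⟨ cong suc x-split ⟨
    suc (capSum j (pairedEvenParts (a ∷ b ∷ ms))) ∎
    where open ≡-Reasoning
  odd : ¬ Even (capSum j (oddParts (a ∷ b ∷ ms)) + j)
  odd = even⇒¬even-suc (∣m∣n⇒∣m+n (m∣m*n (a + j)) even-o)
      ∘ subst Even (trans (cong (_+ j) o-split) (regroup a j o))
    where
    regroup : ∀ a j o → 2 * a + 1 + (j + o) + j ≡ suc (2 * (a + j) + o)
    regroup = solve-∀

pairs-below-shift : ∀ {j a b} ms → a < b → 2 * b + 1 < j → PairingDefect j ms → PairingDefect j (a ∷ b ∷ ms)
pairs-below-shift {j} {a} {b} ms a<b 2b+1<j =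
  defect-shift (m∣m*n (suc (a + b))) (divides 0 refl) o-split x-split g-split g′-split
  where
  2a+1≤2b+1 : 2 * a + 1 ≤ 2 * b + 1
  2a+1≤2b+1 = +-monoˡ-≤ 1 (*-monoʳ-≤ 2 (<⇒≤ a<b))
  o x : ℕ
  o = capSum j (oddParts ms)
  x = capSum j (pairedEvenParts ms)
  o-split : capSum j (oddParts (a ∷ b ∷ ms)) ≡ 2 * suc (a + b) + o
  o-split = trans (cong₂ (λ u v → u + (v + o)) (m≤n⇒m⊓n≡m (≤-trans 2a+1≤2b+1 (<⇒≤ 2b+1<j)))
                                               (m≤n⇒m⊓n≡m (<⇒≤ 2b+1<j)))
                  (regroup a b o)
    where
    regroup : ∀ a b o → 2 * a + 1 + (2 * b + 1 + o) ≡ 2 * suc (a + b) + o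
    regroup = solve-∀
  x-split : capSum j (pairedEvenParts (a ∷ b ∷ ms)) ≡ 2 * suc (a + b) + x
  x-split = trans (cong₂ (λ u v → u + (v + x))
                     (m≤n⇒m⊓n≡m (≤-trans (m≤m+n _ 1) (≤-trans 2a+1≤2b+1 (<⇒≤ 2b+1<j))))
                     (m≤n⇒m⊓n≡m (≤-trans (≤-reflexive (trans (*-suc 2 b) (cong suc (sym (2m+1≡1+2m b))))) 2b+1<j)))
                  (regroup a b x)
    where
    regroup : ∀ a b x → 2 * a + (2 * suc b + x) ≡ 2 * suc (a + b) + x
    regroup = solve-∀
  g-split : countGe j (oddParts (a ∷ b ∷ ms)) ≡ 0 + countGe j (oddParts ms)
  g-split = trans (countGe-∷-≰ _ (<⇒≱ (≤-<-trans 2a+1≤2b+1 2b+1<j))) (countGe-∷-≰ _ (<⇒≱ 2b+1<j))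
  g′-split : countGe (suc j) (oddParts (a ∷ b ∷ ms)) ≡ 0 + countGe (suc j) (oddParts ms)
  g′-split = trans (countGe-∷-≰ _ (<⇒≱ (≤-<-trans 2a+1≤2b+1 (m<n⇒m<1+n 2b+1<j))))
                   (countGe-∷-≰ _ (<⇒≱ (m<n⇒m<1+n 2b+1<j)))

pairing-defect : ∀ j ms → Linked _<_ ms → Even (length ms) → PairingDefect j ms
pairing-defect j []           _   _        = inj₁ (refl , divides 0 refl , refl , divides 0 refl)
pairing-defect j (a ∷ [])     _   even-len = ⊥-elim (¬even-1 even-len)
pairing-defect j (a ∷ b ∷ ms) lnk even-len with j ≤? 2 * a | j ≤? 2 * b + 1
... | yes j≤2a | _ = inj₁ (pairs-above-balanced (a ∷ b ∷ ms) even-len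
       (All.map (λ a≤m → ≤-trans j≤2a (*-monoʳ-≤ 2 a≤m)) (≤-refl ∷ All.map <⇒≤ (<-linked⇒head< lnk))))
... | no j≰2a | yes j≤2b+1 = inj₂ (straddling-pair-excess ms (≰⇒> j≰2a) j≤2b+1 (Linked.head lnk)
       (pairs-above-balanced ms (even-2+⇒even even-len)
         (All.map (λ b<m → ≤-trans j≤2b+1 (≤-trans (2m+1≤2[1+m] b) (*-monoʳ-≤ 2 b<m)))
                  (<-linked⇒head< (Linked.tail lnk)))))
... | no _    | no j≰2b+1 = pairs-below-shift ms (Linked.head lnk) (≰⇒> j≰2b+1)
       (pairing-defect j ms (Linked.tail (Linked.tail lnk)) (even-2+⇒even even-len))

pairedEven-dominated : ∀ {ms} → Linked _<_ ms → Even (length ms) →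
  Dom (transpose (pairedEvenParts ms)) (transpose (oddParts ms))
pairedEven-dominated {ms} increasing even-len j
  rewrite psum-transpose j (pairedEvenParts ms) | psum-transpose j (oddParts ms)
  with pairing-defect j ms increasing even-len
... | inj₁ (o≡x , _)   = ≤-reflexive (sym o≡x)
... | inj₂ (o≡1+x , _) = ≤-trans (n≤1+n _) (≤-reflexive (sym o≡1+x))

pairedEven-dominated-by-dual : ∀ {ms e} → Linked _<_ ms → Even (length ms) → IsBVdual (oddParts ms) e →
  Dom (transpose (pairedEvenParts ms)) e
pairedEven-dominated-by-dual {ms} increasing even-len (_ , _ , _ , _ , e-max) =
  e-max _ (transpose-isPartition (pairedEvenParts ms)) (transpose-double-orth (raisePairs ms))
    (trans (sum-transpose (pairedEvenParts ms))
      (trans (sum-pairedEvenParts ms even-len) (sym (sum-transpose (oddParts ms)))))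
    (pairedEven-dominated increasing even-len)

-- Adding 2A

psum-transpose-doubled-++ : ∀ j as L →
  psum j (transpose (doubled as ++ L)) ≡ capSum j as + capSum j as + capSum j L
psum-transpose-doubled-++ j as L = begin
  psum j (transpose (doubled as ++ L))   ≡⟨ psum-transpose j (doubled as ++ L) ⟩
  capSum j (doubled as ++ L)             ≡⟨ capSum-++ j (doubled as) L ⟩
  capSum j (doubled as) + capSum j L     ≡⟨ cong (_+ capSum j L) (capSum-doubled j as) ⟩
  capSum j as + capSum j as + capSum j L ∎
  where open ≡-Reasoning

+-cancel-dominated : ∀ {u u′ v v′} → u′ ≤ u → v′ ≤ v → u + v ≡ u′ + v′ → v ≡ v′
+-cancel-dominated {u} {u′} {v} {v′} u′≤u v′≤v eq =
  ≤-antisym (+-cancelˡ-≤ u v v′ (≤-trans (≤-reflexive eq) (+-monoˡ-≤ v′ u′≤u))) v′≤v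

doubled-++-flat : ∀ as L i →
  countGe i (doubled as ++ L) ≡ countGe (suc i) (doubled as ++ L) × Even (countGe i (doubled as ++ L)) →
  countGe i L ≡ countGe (suc i) L × Even (countGe i L)
doubled-++-flat as L i (flat , even) =
  +-cancel-dominated (+-mono-≤ α′≤α α′≤α) (countGe-suc-≤ i L) (trans (sym (split i)) (trans flat (split (suc i)))) ,
  ∣m+n∣m⇒∣n (subst Even (split i) even) (even-double (countGe i as))
  where
  split : ∀ k → countGe k (doubled as ++ L) ≡ countGe k as + countGe k as + countGe k L
  split k = trans (countGe-++ k (doubled as) L) (cong (_+ countGe k L) (countGe-doubled k as))
  α′≤α : countGe (suc i) as ≤ countGe i as
  α′≤α = countGe-suc-≤ i as

orth-dominated-pairedEven : ∀ as {ms} → Linked _<_ ms → Even (length ms) → ∀ {r} → Linked _≥_ r → Orth r →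
  Dom r (transpose (doubled as ++ oddParts ms)) → Dom r (transpose (doubled as ++ pairedEvenParts ms))
orth-dominated-pairedEven as {ms} increasing even-len {r} lnk orth r≤P = r≤Q
  where
  P Q : List ℕ
  P = transpose (doubled as ++ oddParts ms)
  Q = transpose (doubled as ++ pairedEvenParts ms)
  αα : ℕ → ℕ
  αα k = capSum k as + capSum k as
  P≡ : ∀ k → psum k P ≡ αα k + capSum k (oddParts ms)
  P≡ k = psum-transpose-doubled-++ k as (oddParts ms)
  Q≡ : ∀ k → psum k Q ≡ αα k + capSum k (pairedEvenParts ms)
  Q≡ k = psum-transpose-doubled-++ k as (pairedEvenParts ms)
  r≤Q : Dom r Q
  r≤Q zero = z≤n
  r≤Q (suc j) with pairing-defect (suc j) ms increasing even-len
  ... | inj₁ (o≡x , _) = begin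
    psum (suc j) r                                   ≤⟨ r≤P (suc j) ⟩
    psum (suc j) P                                   ≡⟨ P≡ (suc j) ⟩
    αα (suc j) + capSum (suc j) (oddParts ms)        ≡⟨ cong (αα (suc j) +_) o≡x ⟩
    αα (suc j) + capSum (suc j) (pairedEvenParts ms) ≡⟨ Q≡ (suc j) ⟨
    psum (suc j) Q                                   ∎
    where open ≤-Reasoning
  ... | inj₂ (o≡1+x , odd , not-flat) with psum (suc j) r ≤? psum (suc j) Q
  ...   | yes r≤Q = r≤Q
  ...   | no  r≰Q = ⊥-elim (not-flat (doubled-++-flat as (oddParts ms) (suc j)
                      (orth-touch-transpose (doubled as ++ oddParts ms) lnk orth r≤P j touch odd-r)))
    where
    P≡1+Q : psum (suc j) P ≡ suc (psum (suc j) Q)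
    P≡1+Q = trans (P≡ (suc j)) (trans (cong (αα (suc j) +_) o≡1+x) (trans (+-suc _ _) (cong suc (sym (Q≡ (suc j))))))
    touch : psum (suc j) r ≡ psum (suc j) P
    touch = ≤-antisym (r≤P (suc j)) (≤-trans (≤-reflexive P≡1+Q) (≰⇒> r≰Q))
    odd-r : ¬ Even (psum (suc j) r + suc j)
    odd-r = ¬even-+ˡ (even-double (capSum (suc j) as)) odd
          ∘ subst Even (trans (cong (_+ suc j) (trans touch (P≡ (suc j)))) (+-assoc (αα (suc j)) _ (suc j)))

psum-addP-double : ∀ j A e → psum j (addP (addP A A) e) ≡ psum j A + psum j A + psum j e
psum-addP-double j A e = trans (psum-addP j (addP A A) e) (cong (_+ psum j e) (psum-addP j A A))

psum-transpose-doubled-++-addP : ∀ j as L →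
  psum j (transpose (doubled as ++ L)) ≡ psum j (addP (addP (transpose as) (transpose as)) (transpose L))
psum-transpose-doubled-++-addP j as L = begin
  psum j (transpose (doubled as ++ L))   ≡⟨ psum-transpose-doubled-++ j as L ⟩
  capSum j as + capSum j as + capSum j L ≡⟨ cong₂ (λ u v → u + u + v) (psum-transpose j as) (psum-transpose j L) ⟨
  psum j (transpose as) + psum j (transpose as) + psum j (transpose L)
                                         ≡⟨ psum-addP-double j (transpose as) (transpose L) ⟨
  psum j (addP (addP (transpose as) (transpose as)) (transpose L)) ∎
  where open ≡-Reasoning

addP-double-mono : ∀ A {q s} → Dom q s → Dom (addP (addP A A) q) (addP (addP A A) s)
addP-double-mono A {q} {s} q≤s j = begin
  psum j (addP (addP A A) q)     ≡⟨ psum-addP-double j A q ⟩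
  psum j A + psum j A + psum j q ≤⟨ +-monoʳ-≤ (psum j A + psum j A) (q≤s j) ⟩
  psum j A + psum j A + psum j s ≡⟨ psum-addP-double j A s ⟨
  psum j (addP (addP A A) s)     ∎
  where open ≤-Reasoning

dom-addP-transpose : ∀ as L {q} → Dom q (transpose L) →
  Dom (addP (addP (transpose as) (transpose as)) q) (transpose (doubled as ++ L))
dom-addP-transpose as L q≤Lᵗ j =
  ≤-trans (addP-double-mono (transpose as) q≤Lᵗ j) (≤-reflexive (sym (psum-transpose-doubled-++-addP j as L)))

dom-transpose-addP : ∀ as L {q} → Dom (transpose L) q →
  Dom (transpose (doubled as ++ L)) (addP (addP (transpose as) (transpose as)) q)
dom-transpose-addP as L Lᵗ≤q j =
  ≤-trans (≤-reflexive (psum-transpose-doubled-++-addP j as L)) (addP-double-mono (transpose as) Lᵗ≤q j)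

sum-addP-transpose : ∀ as L {q} → sum q ≡ sum L →
  sum (addP (addP (transpose as) (transpose as)) q) ≡ sum (transpose (doubled as ++ L))
sum-addP-transpose as L {q} sum-q = begin
  sum (addP (addP A A) q)            ≡⟨ trans (sum-addP (addP A A) q) (cong (_+ sum q) (sum-addP A A)) ⟩
  sum A + sum A + sum q              ≡⟨ cong₂ (λ u v → u + u + v) (sum-transpose as) sum-q ⟩
  sum as + sum as + sum L            ≡⟨ cong (_+ sum L) (sum-doubled as) ⟨
  sum (doubled as) + sum L           ≡⟨ sum-++ (doubled as) L ⟨
  sum (doubled as ++ L)              ≡⟨ sum-transpose (doubled as ++ L) ⟨
  sum (transpose (doubled as ++ L))  ∎
  where
  open ≡-Reasoning
  A : List ℕ
  A = transpose as

lemma7p1 : (as ms : List ℕ) → All (0 <_) as →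
    Even (length ms) → All (0 <_) ms → Linked _<_ ms →
    (e r : List ℕ) →
    IsBVdual (oddParts ms) e →
    IsOCollapse (addP (addP (transpose as) (transpose as)) e) r → IsBVdual (doubled as ++ oddParts ms) r
lemma7p1 as ms _ even-len _ increasing e r e-dual@(_ , _ , sum-e , e≤Oᵗ , _)
         (r-part , r-orth , sum-r , r≤P′ , r-max) =
  r-part , r-orth , trans sum-r sum-P′≡sum-P , dom-trans r≤P′ (dom-addP-transpose as (oddParts ms) e≤Oᵗ) , maximal
  where
  sum-P′≡sum-P : sum (addP (addP (transpose as) (transpose as)) e) ≡ sum (transpose (doubled as ++ oddParts ms))
  sum-P′≡sum-P = sum-addP-transpose as (oddParts ms) (trans sum-e (sum-transpose (oddParts ms)))
  maximal : ∀ r′ → IsPartition r′ → Orth r′ → sum r′ ≡ sum (transpose (doubled as ++ oddParts ms)) →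
    Dom r′ (transpose (doubled as ++ oddParts ms)) → Dom r′ r
  maximal r′ r′-part r′-orth sum-r′ r′≤P =
    r-max r′ r′-part r′-orth (trans sum-r′ (sym sum-P′≡sum-P))
      (dom-trans (orth-dominated-pairedEven as increasing even-len (proj₁ r′-part) r′-orth r′≤P)
                 (dom-transpose-addP as (pairedEvenParts ms)
                    (pairedEven-dominated-by-dual increasing even-len e-dual)))
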